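{- For all positive integers $k,\ell$, the canonical $k\times\ell$ grid permutation has twin-width $\min(k,\ell)$.
   Context: The canonical $k\times\ell$ grid permutation is the permutation corresponding to the point set $\{((i-1)\ell+(\ell-j+1),\,(j-1)k+i) : i\in[k], j\in[\ell]\}$ (a point set in general position corresponds to the permutation obtained by listing points by increasing $x$ and recording ranks of $y$-coordinates). The twin-width of a permutation is the twin-width of any corresponding point set. Twin-width: a rectangle family is a set of axis-parallel rectangles (points are degenerate rectangles). Merging two rectangles replaces them by their bounding box. A merge sequence of an $n$-point set $P$ is a sequence $\mathscr{R}_1=P,\dots,\mathscr{R}_n$ of rectangle families with $\mathscr{R}_n$ a single rectangle and each $\mathscr{R}_{i+1}$ obtained from $\mathscr{R}_i$ by merging two rectangles. Two rectangles are homogeneous if both their $x$-projections and their $y$-projections are disjoint. The red graph of $\mathscr{R}_i$ joins every two distinct non-homogeneous rectangles. A merge sequence is $d$-wide if all red graphs have maximum degree $<d$; the twin-width is the least such $d$. -}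

module Defs where

open import Data.Nat using (ℕ; zero; suc; _+_; _*_; _∸_; _<_; _≤_; _⊓_; _⊔_; _<ᵇ_; _≡ᵇ_)
open import Data.Bool using (Bool; true; false; _∧_; _∨_; not; if_then_else_)
open import Data.Fin using (Fin; toℕ)
open import Data.List using (List; []; _∷_; [_]; map; length; lookup; allFin; upTo; concatMap)
open import Data.Nat.ListAction using (sum)
open import Data.List.Relation.Binary.Permutation.Propositional using (_↭_)
open import Data.Product using (_×_; _,_; ∃; ∃-syntax; Σ-syntax)
open import Relation.Binary.PropositionalEquality using (_≡_)

-- A point of the plane (natural-number coordinates suffice: the point sets
-- considered are finite sets of points with integer coordinates).
Point : Set
Point = ℕ × ℕ

record Rect : Set where
  constructor rect
  field
    xlo xhi ylo yhi : ℕ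
open Rect public

pointRect : Point → Rect
pointRect (x , y) = rect x x y y

bbox : Rect → Rect → Rect
bbox a b = rect (xlo a ⊓ xlo b) (xhi a ⊔ xhi b) (ylo a ⊓ ylo b) (yhi a ⊔ yhi b)

disjointᵇ : ℕ → ℕ → ℕ → ℕ → Bool
disjointᵇ a1 a2 b1 b2 = (a2 <ᵇ b1) ∨ (b2 <ᵇ a1)

homogeneousᵇ : Rect → Rect → Bool
homogeneousᵇ a b = disjointᵇ (xlo a) (xhi a) (xlo b) (xhi b)
                 ∧ disjointᵇ (ylo a) (yhi a) (ylo b) (yhi b)

-- A rectangle family, as a list (rectangles are identified by position).
Family : Set
Family = List Rect

redDeg : (F : Family) → Fin (length F) → ℕ
redDeg F i = sum (map (λ j → if not (toℕ j ≡ᵇ toℕ i) ∧ not (homogeneousᵇ (lookup F i) (lookup F j))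
                             then 1 else 0)
                      (allFin (length F)))

RedBelow : ℕ → Family → Set
RedBelow d F = (i : Fin (length F)) → redDeg F i < d

MergeStep : Family → Family → Set
MergeStep F F' = ∃[ a ] ∃[ b ] ∃[ rest ] (F ↭ (a ∷ b ∷ rest)) × (F' ≡ bbox a b ∷ rest)

data WideMergeSeq (d : ℕ) : Family → Set where
  done : (r : Rect) → RedBelow d [ r ] → WideMergeSeq d [ r ]
  step : {F F' : Family} → RedBelow d F → MergeStep F F' → WideMergeSeq d F' → WideMergeSeq d F

HasWideMergeSeq : ℕ → List Point → Set
HasWideMergeSeq d P = WideMergeSeq d (map pointRect P)

IsTwinWidth : List Point → ℕ → Set
IsTwinWidth P tw = HasWideMergeSeq tw P × ((d : ℕ) → HasWideMergeSeq d P → tw ≤ d)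

-- The point set of the canonical k × ℓ grid permutation:
-- {((i-1)ℓ + (ℓ-j+1), (j-1)k + i) : i ∈ [k], j ∈ [ℓ]}, written with
-- i' = i-1 ∈ [0,k), j' = j-1 ∈ [0,ℓ).
gridPoints : ℕ → ℕ → List Point
gridPoints k ℓ = concatMap (λ i' → map (λ j' → (i' * ℓ + (ℓ ∸ j') , j' * k + suc i')) (upTo ℓ)) (upTo k)

-- Write M = min(k,ℓ).  Upper bound (say k ≤ ℓ): keep one box per column block of the
-- grid and absorb the points in increasing y-order, each into the box of its block.
-- Every box then lies below all unmerged points, and within its block to the right of
-- the block's unmerged points, so it is homogeneous to them; as the unmerged points are
-- pairwise homogeneous, only the k boxes can be red and all red degrees stay < k.
-- For ℓ < k sweep the row blocks in increasing x-order instead.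
-- Lower bound: two grid points always differ by at least M in x or in y, and each
-- coordinate takes every value 1, …, kℓ exactly once.  So the first merge creates a
-- rectangle spanning M + 1 values of some coordinate; it meets M + 1 points, at least
-- M - 1 of them outside the merged pair, hence has red degree ≥ M - 1.
module Submission where

open import Defs
open import Data.Bool using (true; false; T; not; _∧_; if_then_else_)
open import Data.Bool.Properties using (T-∧; T-∨)
open import Data.Empty using (⊥; ⊥-elim)
open import Data.Fin using (Fin; toℕ) renaming (zero to fzero; suc to fsuc)
open import Data.List
  using (List; []; _∷_; [_]; _++_; map; length; lookup; tabulate; concat; applyUpTo; upTo)
open import Data.List.Properties
  using ( map-tabulate; tabulate-lookup; ++-identityʳ; applyUpTo-∷ʳ; length-applyUpTo
        ; map-∘; map-upTo; map-applyUpTo; map-concatMap )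
open import Data.List.Membership.Propositional using (_∈_)
open import Data.List.Membership.Propositional.Properties using (∈-lookup; ∈-applyUpTo⁻)
open import Data.List.Relation.Unary.All using (All; []; _∷_)
import Data.List.Relation.Unary.All as All
import Data.List.Relation.Unary.All.Properties as All
open import Data.List.Relation.Unary.AllPairs using (AllPairs; []; _∷_)
import Data.List.Relation.Unary.AllPairs.Properties as AllPairs
open import Data.List.Relation.Unary.Any using (here; there)
open import Data.List.Relation.Binary.Permutation.Propositional
  using (_↭_; ↭⇒↭ₛ; ↭-refl; ↭-sym; ↭-trans; ↭-reflexive; prep)
open import Data.List.Relation.Binary.Permutation.Propositional.Properties
  using (↭-singleton-inv; ↭-length; ∈-resp-↭; All-resp-↭; map⁺; ++⁺; ++⁺ˡ; ++⁺ʳ; shift; shifts; ∷↭∷ʳ)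
import Data.List.Relation.Binary.Permutation.Setoid.Properties as PermutationProperties
open import Data.Nat
  using ( ℕ; NonZero; zero; suc; pred; _+_; _*_; _∸_; _⊓_; _⊔_; _≤_; _<_; _≥_; z≤n; s≤s; z<s; s<s
        ; s<s⁻¹; _≤?_; _<?_; _≡ᵇ_ )
open import Data.Nat.Properties
open import Data.Nat.DivMod
open import Data.Nat.Divisibility using (n∣m*n)
open import Data.Nat.ListAction using (sum)
open import Data.Nat.ListAction.Properties using (sum-↭)
open import Data.Product using (Σ; _×_; _,_; proj₁; proj₂)
open import Data.Sum using (_⊎_; inj₁; inj₂)
import Data.Sum as Sum
open import Function using (_∘_; _$_; id; _⇔_; mk⇔; Equivalence)
open import Relation.Binary.Definitions using (tri<; tri≈; tri>)
open import Relation.Binary.PropositionalEquality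
  using (_≡_; refl; sym; trans; cong; cong₂; subst; subst₂; resp₂; module ≡-Reasoning)
import Relation.Binary.PropositionalEquality as ≡
open import Relation.Nullary using (yes; no)

data Axis : Set where
  horizontal vertical : Axis

lo hi : Axis → Rect → ℕ
lo horizontal = xlo
lo vertical   = ylo
hi horizontal = xhi
hi vertical   = yhi

coord : Axis → Point → ℕ
coord horizontal = proj₁
coord vertical   = proj₂

lo-point : ∀ ax q → lo ax (pointRect q) ≡ coord ax q
lo-point horizontal q = refl
lo-point vertical   q = refl

hi-point : ∀ ax q → hi ax (pointRect q) ≡ coord ax q
hi-point horizontal q = refl
hi-point vertical   q = refl

lo-bbox : ∀ ax a b → lo ax (bbox a b) ≡ lo ax a ⊓ lo ax b
lo-bbox horizontal a b = refl
lo-bbox vertical   a b = refl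

hi-bbox : ∀ ax a b → hi ax (bbox a b) ≡ hi ax a ⊔ hi ax b
hi-bbox horizontal a b = refl
hi-bbox vertical   a b = refl

rect-≡ : ∀ {a b c d a′ b′ c′ d′} → a ≡ a′ → b ≡ b′ → c ≡ c′ → d ≡ d′ → rect a b c d ≡ rect a′ b′ c′ d′
rect-≡ refl refl refl refl = refl

-- The closed intervals [a₁,a₂] and [b₁,b₂] are at distance at least M;
-- Gap 1 is disjointness.
Gap : ℕ → ℕ → ℕ → ℕ → ℕ → Set
Gap M a₁ a₂ b₁ b₂ = M + a₂ ≤ b₁ ⊎ M + b₂ ≤ a₁

Separated : ℕ → Axis → Rect → Rect → Set
Separated M ax a b = Gap M (lo ax a) (hi ax a) (lo ax b) (hi ax b)

Separated-sym : ∀ {M} ax a b → Separated M ax a b → Separated M ax b a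
Separated-sym _ _ _ = Sum.swap

-- A record rather than T (homogeneousᵇ a b), so that a and b can be inferred.
record Homogeneous (a b : Rect) : Set where
  constructor homogeneous
  field isHomogeneous : T (homogeneousᵇ a b)

T-disjointᵇ : ∀ a₁ a₂ b₁ b₂ → T (disjointᵇ a₁ a₂ b₁ b₂) ⇔ Gap 1 a₁ a₂ b₁ b₂
T-disjointᵇ a₁ a₂ b₁ b₂ = mk⇔
  (Sum.map (<ᵇ⇒< a₂ b₁) (<ᵇ⇒< b₂ a₁) ∘ Equivalence.to T-∨)
  (Equivalence.from T-∨ ∘ Sum.map <⇒<ᵇ <⇒<ᵇ)

homogeneous⁺ : ∀ {a b} → Separated 1 horizontal a b → Separated 1 vertical a b → Homogeneous a b
homogeneous⁺ {a} {b} sx sy = homogeneous $ Equivalence.from T-∧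
  ( Equivalence.from (T-disjointᵇ (xlo a) (xhi a) (xlo b) (xhi b)) sx
  , Equivalence.from (T-disjointᵇ (ylo a) (yhi a) (ylo b) (yhi b)) sy )

homogeneous⁻ : ∀ {a b} → Homogeneous a b → ∀ ax → Separated 1 ax a b
homogeneous⁻ {a} {b} (homogeneous h) horizontal =
  Equivalence.to (T-disjointᵇ (xlo a) (xhi a) (xlo b) (xhi b)) (proj₁ (Equivalence.to T-∧ h))
homogeneous⁻ {a} {b} (homogeneous h) vertical =
  Equivalence.to (T-disjointᵇ (ylo a) (yhi a) (ylo b) (yhi b)) (proj₂ (Equivalence.to T-∧ h))

Homogeneous-sym : ∀ {a b} → Homogeneous a b → Homogeneous b a
Homogeneous-sym {a} {b} h =
  homogeneous⁺ (Separated-sym horizontal a b (homogeneous⁻ h horizontal))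
               (Separated-sym vertical a b (homogeneous⁻ h vertical))

_⊆_ : Rect → Rect → Set
r ⊆ s = ∀ ax → lo ax s ≤ lo ax r × hi ax r ≤ hi ax s

⊆-refl : ∀ r → r ⊆ r
⊆-refl r ax = ≤-refl , ≤-refl

⊆-bboxʳ : ∀ a b → b ⊆ bbox a b
⊆-bboxʳ a b horizontal = m⊓n≤n (xlo a) (xlo b) , m≤n⊔m (xhi a) (xhi b)
⊆-bboxʳ a b vertical   = m⊓n≤n (ylo a) (ylo b) , m≤n⊔m (yhi a) (yhi b)

Gap-shrink : ∀ {M a₁ a₂ b₁ b₂ c₁ c₂} → a₁ ≤ c₁ → c₂ ≤ a₂ → Gap M a₁ a₂ b₁ b₂ → Gap M c₁ c₂ b₁ b₂
Gap-shrink {M} a₁≤c₁ c₂≤a₂ (inj₁ gap) = inj₁ (≤-trans (+-monoʳ-≤ M c₂≤a₂) gap)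
Gap-shrink     a₁≤c₁ c₂≤a₂ (inj₂ gap) = inj₂ (≤-trans gap a₁≤c₁)

Homogeneous-⊆ : ∀ {r s q} → r ⊆ s → Homogeneous s q → Homogeneous r q
Homogeneous-⊆ {r} {s} {q} r⊆s h = homogeneous⁺ (shrink horizontal) (shrink vertical)
  where
  shrink : ∀ ax → Separated 1 ax r q
  shrink ax = Gap-shrink (proj₁ (r⊆s ax)) (proj₂ (r⊆s ax)) (homogeneous⁻ h ax)

clash : Rect → Rect → ℕ
clash a b = if not (homogeneousᵇ a b) then 1 else 0

redCount : Rect → Family → ℕ
redCount a F = sum (map (clash a) F)

redEdge : (F : Family) → Fin (length F) → Fin (length F) → ℕ
redEdge F i j = if not (toℕ j ≡ᵇ toℕ i) ∧ not (homogeneousᵇ (lookup F i) (lookup F j)) then 1 else 0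

clash≤1 : ∀ a b → clash a b ≤ 1
clash≤1 a b with homogeneousᵇ a b
... | true  = z≤n
... | false = ≤-refl

clash-homogeneous : ∀ {a b} → Homogeneous a b → clash a b ≡ 0
clash-homogeneous {a} {b} (homogeneous h) with homogeneousᵇ a b
... | true = refl

clash-inhomogeneous : ∀ {a b} → (Homogeneous a b → ⊥) → clash a b ≡ 1
clash-inhomogeneous {a} {b} ¬h with homogeneousᵇ a b in eq
... | true  = ⊥-elim (¬h (homogeneous (subst T (sym eq) _)))
... | false = refl

redCount-homogeneous : ∀ {a} F → All (Homogeneous a) F → redCount a F ≡ 0
redCount-homogeneous []      []       = refl
redCount-homogeneous (b ∷ F) (h ∷ hs) = cong₂ _+_ (clash-homogeneous h) (redCount-homogeneous F hs)

redCount-++-≤ : ∀ a Bs Ps → All (Homogeneous a) Ps → redCount a (Bs ++ Ps) ≤ length Bs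
redCount-++-≤ a []       Ps hs = ≤-reflexive (redCount-homogeneous Ps hs)
redCount-++-≤ a (b ∷ Bs) Ps hs = +-mono-≤ (clash≤1 a b) (redCount-++-≤ a Bs Ps hs)

redDeg-head : ∀ a F → redDeg (a ∷ F) fzero ≡ redCount a F
redDeg-head a F = begin
  redDeg (a ∷ F) fzero                      ≡⟨ cong sum (map-tabulate fsuc (redEdge (a ∷ F) fzero)) ⟩
  sum (tabulate (clash a ∘ lookup F))       ≡⟨ cong sum (sym (map-tabulate (lookup F) (clash a))) ⟩
  sum (map (clash a) (tabulate (lookup F))) ≡⟨ cong (sum ∘ map (clash a)) (tabulate-lookup F) ⟩
  redCount a F                              ∎
  where open ≡-Reasoning

redDeg-tail : ∀ a F i → redDeg (a ∷ F) (fsuc i) ≡ clash (lookup F i) a + redDeg F i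
redDeg-tail a F i = cong (clash (lookup F i) a +_) (trans
  (cong sum (map-tabulate fsuc (redEdge (a ∷ F) (fsuc i))))
  (sym (cong sum (map-tabulate id (redEdge F i)))))

redDeg-pairwise : ∀ F i → AllPairs Homogeneous F → redDeg F i ≡ 0
redDeg-pairwise (a ∷ F) fzero    (ha ∷ _)  = trans (redDeg-head a F) (redCount-homogeneous F ha)
redDeg-pairwise (a ∷ F) (fsuc i) (ha ∷ hF) = trans (redDeg-tail a F i)
  (cong₂ _+_ (clash-homogeneous (Homogeneous-sym (All.lookup ha (∈-lookup i)))) (redDeg-pairwise F i hF))

redDeg-++-≤ : ∀ Bs Ps i → All (λ b → All (Homogeneous b) Ps) Bs → AllPairs Homogeneous Ps →
              redDeg (Bs ++ Ps) i ≤ length Bs ∸ 1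
redDeg-++-≤ []       Ps i        _          hPs = ≤-reflexive (redDeg-pairwise Ps i hPs)
redDeg-++-≤ (b ∷ Bs) Ps fzero    (hb ∷ _)   _   =
  ≤-trans (≤-reflexive (redDeg-head b (Bs ++ Ps))) (redCount-++-≤ b Bs Ps hb)
redDeg-++-≤ (b ∷ []) Ps (fsuc i) (hb ∷ _)   hPs = ≤-reflexive (trans (redDeg-tail b Ps i)
  (cong₂ _+_ (clash-homogeneous (Homogeneous-sym (All.lookup hb (∈-lookup i)))) (redDeg-pairwise Ps i hPs)))
redDeg-++-≤ (b ∷ c ∷ Bs) Ps (fsuc i) (_ ∷ hBs) hPs = ≤-trans (≤-reflexive (redDeg-tail b (c ∷ Bs ++ Ps) i))
  (+-mono-≤ (clash≤1 (lookup (c ∷ Bs ++ Ps) i) b) (redDeg-++-≤ (c ∷ Bs) Ps i hBs hPs))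

RedBelow-++ : ∀ {d} Bs Ps → 1 ≤ d → length Bs ≤ d →
              All (λ b → All (Homogeneous b) Ps) Bs → AllPairs Homogeneous Ps → RedBelow d (Bs ++ Ps)
RedBelow-++ Bs Ps 1≤d |Bs|≤d hBs hPs i = ≤-<-trans (redDeg-++-≤ Bs Ps i hBs hPs) (pred< 1≤d |Bs|≤d)
  where
  pred< : ∀ {n d} → 1 ≤ d → n ≤ d → n ∸ 1 < d
  pred< {zero}  1≤d _       = 1≤d
  pred< {suc n} _   1+n≤d = 1+n≤d

RedBelow-short : ∀ {d} F → 1 ≤ d → length F ≤ d → RedBelow d F
RedBelow-short {d} F 1≤d |F|≤d = subst (RedBelow d) (++-identityʳ F)
  (RedBelow-++ F [] 1≤d |F|≤d (All.universal (λ _ → []) F) [])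

WideMergeSeq-RedBelow : ∀ {d F} → WideMergeSeq d F → RedBelow d F
WideMergeSeq-RedBelow (done _ rb)   = rb
WideMergeSeq-RedBelow (step rb _ _) = rb

WideMergeSeq-width : ∀ {d F} → WideMergeSeq d F → 1 ≤ d
WideMergeSeq-width (done _ rb)    = rb fzero
WideMergeSeq-width (step _ _ seq) = WideMergeSeq-width seq

WideMergeSeq-resp-↭ : ∀ {d F G} → G ↭ F → RedBelow d G → WideMergeSeq d F → WideMergeSeq d G
WideMergeSeq-resp-↭ G↭F rbG (done r _) rewrite ↭-singleton-inv G↭F = done r rbG
WideMergeSeq-resp-↭ G↭F rbG (step _ (a , b , rest , F↭ , F′≡) seq) =
  step rbG (a , b , rest , ↭-trans G↭F F↭ , F′≡) seq

mergeAll : ∀ {d} r rs → suc (length rs) ≤ d → WideMergeSeq d (r ∷ rs)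
mergeAll r []       1≤d   = done r (RedBelow-short [ r ] 1≤d 1≤d)
mergeAll r (s ∷ rs) |F|≤d =
  step (RedBelow-short (r ∷ s ∷ rs) (≤-trans (s≤s z≤n) |F|≤d) |F|≤d) (r , s , rs , ↭-refl , refl)
       (mergeAll (bbox r s) rs (≤-trans (n≤1+n _) |F|≤d))

applyUpTo-cong : ∀ {A : Set} {f g : ℕ → A} n → (∀ i → i < n → f i ≡ g i) → applyUpTo f n ≡ applyUpTo g n
applyUpTo-cong zero    _   = refl
applyUpTo-cong (suc n) f≡g = cong₂ _∷_ (f≡g 0 z<s) (applyUpTo-cong n (λ i i<n → f≡g (suc i) (s<s i<n)))

applyUpTo-+ : ∀ {A : Set} (f : ℕ → A) m n →
              applyUpTo f (m + n) ≡ applyUpTo f m ++ applyUpTo (λ i → f (m + i)) n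
applyUpTo-+ f zero    n = refl
applyUpTo-+ f (suc m) n = cong (f 0 ∷_) (applyUpTo-+ (f ∘ suc) m n)

applyUpTo-blocks : ∀ {A : Set} (f : ℕ → A) L K →
  applyUpTo f (L * K) ≡ concat (applyUpTo (λ s → applyUpTo (λ i → f (s * K + i)) K) L)
applyUpTo-blocks f zero    K = refl
applyUpTo-blocks f (suc L) K = begin
  applyUpTo f (K + L * K)
    ≡⟨ applyUpTo-+ f K (L * K) ⟩
  applyUpTo f K ++ applyUpTo (λ n → f (K + n)) (L * K)
    ≡⟨ cong (applyUpTo f K ++_) (applyUpTo-blocks (λ n → f (K + n)) L K) ⟩
  applyUpTo f K ++ concat (applyUpTo (λ s → applyUpTo (λ i → f (K + (s * K + i))) K) L)
    ≡⟨ cong (λ blocks → applyUpTo f K ++ concat blocks)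
            (applyUpTo-cong L (λ s _ → applyUpTo-cong K (λ i _ → cong f (sym (+-assoc K (s * K) i))))) ⟩
  concat (applyUpTo (λ s → applyUpTo (λ i → f (s * K + i)) K) (suc L))
    ∎
  where open ≡-Reasoning

concat-applyUpTo-∷ : ∀ {A : Set} (x : ℕ → A) (Y : ℕ → List A) L →
  concat (applyUpTo (λ j → x j ∷ Y j) L) ↭ applyUpTo x L ++ concat (applyUpTo Y L)
concat-applyUpTo-∷ x Y zero    = ↭-refl
concat-applyUpTo-∷ x Y (suc L) = prep (x 0) (↭-trans
  (++⁺ˡ (Y 0) (concat-applyUpTo-∷ (x ∘ suc) (Y ∘ suc) L))
  (shifts (Y 0) (applyUpTo (x ∘ suc) L)))

concat-applyUpTo-[] : ∀ {A : Set} L → concat (applyUpTo (λ _ → []) L) ≡ ([] {A = A})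
concat-applyUpTo-[] zero    = refl
concat-applyUpTo-[] (suc L) = concat-applyUpTo-[] L

concat-applyUpTo-transpose : ∀ {A : Set} (f : ℕ → ℕ → A) K L →
  concat (applyUpTo (λ i → applyUpTo (f i) L) K) ↭ concat (applyUpTo (λ j → applyUpTo (λ i → f i j) K) L)
concat-applyUpTo-transpose f zero    L = ↭-reflexive (sym (concat-applyUpTo-[] L))
concat-applyUpTo-transpose f (suc K) L = ↭-trans
  (++⁺ˡ (applyUpTo (f 0) L) (concat-applyUpTo-transpose (f ∘ suc) K L))
  (↭-sym (concat-applyUpTo-∷ (f 0) (λ j → applyUpTo (λ i → f (suc i) j) K) L))

concat-applyUpTo-↭ : ∀ {A : Set} {f g : ℕ → List A} n → (∀ i → i < n → f i ↭ g i) →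
                     concat (applyUpTo f n) ↭ concat (applyUpTo g n)
concat-applyUpTo-↭ zero    _    = ↭-refl
concat-applyUpTo-↭ (suc n) f↭g = ++⁺ (f↭g 0 z<s) (concat-applyUpTo-↭ n λ i i<n → f↭g (suc i) (s<s i<n))

applyUpTo-reverse : ∀ {A : Set} (f : ℕ → A) n → applyUpTo (λ i → f (n ∸ suc i)) n ↭ applyUpTo f n
applyUpTo-reverse f zero    = ↭-refl
applyUpTo-reverse f (suc n) = ↭-trans (prep (f n) (applyUpTo-reverse f n))
  (↭-trans (∷↭∷ʳ (f n) (applyUpTo f n)) (↭-reflexive (applyUpTo-∷ʳ f n)))

AllPairs-resp-↭ : ∀ {A : Set} {R : A → A → Set} → (∀ {a b} → R a b → R b a) →
                  ∀ {xs ys} → xs ↭ ys → AllPairs R xs → AllPairs R ys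
AllPairs-resp-↭ {A} {R} R-sym xs↭ys =
  PermutationProperties.AllPairs-resp-↭ (≡.setoid A) R-sym (resp₂ R) (↭⇒↭ₛ xs↭ys)

sum-applyUpTo-≥ : ∀ (f : ℕ → ℕ) {a b} N → (∀ n → a ≤ n → n < b → 1 ≤ f n) → b ≤ N →
                  b ∸ a ≤ sum (applyUpTo f N)
sum-applyUpTo-≥ f {a} {zero} N _ _ = ≤-trans (≤-reflexive (0∸n≡0 a)) z≤n
sum-applyUpTo-≥ f {zero}  {suc b} (suc N) f≥1 (s≤s b≤N) =
  +-mono-≤ (f≥1 0 z≤n z<s) (sum-applyUpTo-≥ (f ∘ suc) {0} N (λ n _ n<b → f≥1 (suc n) z≤n (s<s n<b)) b≤N)
sum-applyUpTo-≥ f {suc a} {suc b} (suc N) f≥1 (s≤s b≤N) = ≤-trans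
  (sum-applyUpTo-≥ (f ∘ suc) N (λ n a≤n n<b → f≥1 (suc n) (s≤s a≤n) (s<s n<b)) b≤N)
  (m≤n+m _ (f 0))

[m*n+o]%n≡o : ∀ m n {o} .{{_ : NonZero n}} → o < n → (m * n + o) % n ≡ o
[m*n+o]%n≡o m n {o} o<n = trans (cong (_% n) (+-comm (m * n) o)) (trans ([m+kn]%n≡m%n o m n) (m<n⇒m%n≡m o<n))

[m*n+o]/n≡m : ∀ m n {o} .{{_ : NonZero n}} → o < n → (m * n + o) / n ≡ m
[m*n+o]/n≡m m n {o} o<n = begin
  (m * n + o) / n  ≡⟨ +-distrib-/-∣ˡ o (n∣m*n m) ⟩
  m * n / n + o / n ≡⟨ cong₂ _+_ (m*n/n≡m m n) (m<n⇒m/n≡0 o<n) ⟩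
  m + 0             ≡⟨ +-identityʳ m ⟩
  m                 ∎
  where open ≡-Reasoning

/-%-decomposition : ∀ m n .{{_ : NonZero n}} → m / n * n + m % n ≡ m
/-%-decomposition m n = trans (+-comm (m / n * n) (m % n)) (sym (m≡m%n+[m/n]*n m n))

*+-<-lex : ∀ n {i i′ a b} → i < i′ → a < n + b → i * n + a < i′ * n + b
*+-<-lex n {i} {i′} {a} {b} i<i′ a<n+b = begin-strict
  i * n + a       <⟨ +-monoʳ-< (i * n) a<n+b ⟩
  i * n + (n + b) ≡⟨ trans (sym (+-assoc (i * n) n b)) (cong (_+ b) (+-comm (i * n) n)) ⟩
  suc i * n + b   ≤⟨ +-monoˡ-≤ b (*-monoˡ-≤ n i<i′) ⟩
  i′ * n + b      ∎
  where open ≤-Reasoning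

*+-≤-lex : ∀ n {M i i′ a b} → M ≤ n → i < i′ → a ≤ b → M + (i * n + a) ≤ i′ * n + b
*+-≤-lex n {M} {i} {i′} {a} {b} M≤n i<i′ a≤b = begin
  M + (i * n + a) ≤⟨ +-mono-≤ M≤n (+-monoʳ-≤ (i * n) a≤b) ⟩
  n + (i * n + b) ≡⟨ +-assoc n (i * n) b ⟨
  suc i * n + b   ≤⟨ +-monoˡ-≤ b (*-monoˡ-≤ n i<i′) ⟩
  i′ * n + b      ∎
  where open ≤-Reasoning

*+-<-lex⁻ : ∀ n {s j i i′} → i′ < n → s * n + i < j * n + i′ → s < j ⊎ (s ≡ j × i < i′)
*+-<-lex⁻ n {s} {j} {i} {i′} i′<n lex with <-cmp s j
... | tri< s<j _ _ = inj₁ s<j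
... | tri≈ _ refl _ = inj₂ (refl , +-cancelˡ-< (s * n) i i′ lex)
... | tri> _ _ j<s = ⊥-elim (<-asym lex (*+-<-lex n j<s (<-≤-trans i′<n (m≤m+n n i))))

-- Upper bound: sweeping with a fixed number of boxes

-- The boxes start as p 0, …, p (K - 1), and p (K + n) is merged into B n, giving B (K + n).
-- If every box is homogeneous to all rectangles after it, only the K boxes can be red.
module Sweep (w N : ℕ) (p B : ℕ → Rect)
  (B-start     : ∀ n → n < suc w → B n ≡ p n)
  (B-grow      : ∀ n → suc w + n < N → bbox (B n) (p (suc w + n)) ≡ B (suc w + n))
  (B-separated : ∀ n n′ → n < n′ → n′ < N → Homogeneous (B n) (p n′))
  where

  K : ℕ
  K = suc w

  p⊆B : ∀ n → n < N → p n ⊆ B n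
  p⊆B n n<N with n <? K
  ... | yes n<K = subst (p n ⊆_) (sym (B-start n n<K)) (⊆-refl (p n))
  ... | no  n≮K = subst (λ n → p n ⊆ B n) (m+[n∸m]≡n K≤n)
        (subst (p (K + (n ∸ K)) ⊆_) (B-grow (n ∸ K) (subst (_< N) (sym (m+[n∸m]≡n K≤n)) n<N))
               (⊆-bboxʳ (B (n ∸ K)) (p (K + (n ∸ K)))))
    where K≤n = ≮⇒≥ n≮K

  p-pairwise : ∀ n n′ → n < n′ → n′ < N → Homogeneous (p n) (p n′)
  p-pairwise n n′ n<n′ n′<N = Homogeneous-⊆ (p⊆B n (<-trans n<n′ n′<N)) (B-separated n n′ n<n′ n′<N)

  boxes : ℕ → List Rect
  boxes m = applyUpTo (λ i → B (i + m)) K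

  laterBoxes : ℕ → List Rect
  laterBoxes m = applyUpTo (λ i → B (suc i + m)) w

  pending : ℕ → ℕ → List Rect
  pending m r = applyUpTo (λ i → p (i + (K + m))) r

  state : ℕ → ℕ → Family
  state m r = boxes m ++ pending m r

  boxes-separated : ∀ m r → K + m + r ≡ N → All (λ b → All (Homogeneous b) (pending m r)) (boxes m)
  boxes-separated m r eq = All.applyUpTo⁺₁ _ K λ {i} i<K → All.applyUpTo⁺₁ _ r λ {j} j<r →
    B-separated (i + m) (j + (K + m))
      (<-≤-trans (+-monoˡ-< m i<K) (m≤n+m (K + m) j))
      (subst (j + (K + m) <_) (trans (+-comm r (K + m)) eq) (+-monoˡ-< (K + m) j<r))

  pending-pairwise : ∀ m r → K + m + r ≡ N → AllPairs Homogeneous (pending m r)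
  pending-pairwise m r eq = AllPairs.applyUpTo⁺₁ _ r λ {i} {j} i<j j<r →
    p-pairwise (i + (K + m)) (j + (K + m)) (+-monoˡ-< (K + m) i<j)
      (subst (j + (K + m) <_) (trans (+-comm r (K + m)) eq) (+-monoˡ-< (K + m) j<r))

  RedBelow-state : ∀ {Bs} m r → Bs ↭ boxes m → K + m + r ≡ N → RedBelow K (Bs ++ pending m r)
  RedBelow-state m r Bs↭ eq = RedBelow-++ _ (pending m r) (s≤s z≤n)
    (≤-reflexive (trans (↭-length Bs↭) (length-applyUpTo (λ i → B (i + m)) K)))
    (All-resp-↭ (↭-sym Bs↭) (boxes-separated m r eq)) (pending-pairwise m r eq)

  state-unfold : ∀ m r → state m (suc r) ↭ B m ∷ p (K + m) ∷ laterBoxes m ++ pending (suc m) r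
  state-unfold m r = prep (B m) (↭-trans (shift (p (K + m)) (laterBoxes m) _)
    (prep (p (K + m)) (++⁺ˡ (laterBoxes m) (↭-reflexive (applyUpTo-cong r λ i _ →
      cong p (trans (sym (+-suc i (K + m))) (cong (i +_) (sym (+-suc K m)))))))))

  boxes-rotate : ∀ m → B (K + m) ∷ laterBoxes m ↭ boxes (suc m)
  boxes-rotate m = ↭-trans (∷↭∷ʳ (B (K + m)) (laterBoxes m)) (↭-reflexive (trans
    (applyUpTo-∷ʳ (λ i → B (suc i + m)) w) (applyUpTo-cong K λ i _ → cong B (sym (+-suc i m)))))

  sweep : ∀ m r → K + m + r ≡ N → WideMergeSeq K (state m r)
  sweep m zero    eq = subst (WideMergeSeq K) (sym (++-identityʳ (boxes m)))
    (mergeAll (B m) (laterBoxes m) (≤-reflexive (cong suc (length-applyUpTo (λ i → B (suc i + m)) w))))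
  sweep m (suc r) eq =
    step (RedBelow-state m (suc r) ↭-refl eq) (B m , p (K + m) , _ , state-unfold m r , refl)
      (subst (λ b → WideMergeSeq K (b ∷ laterBoxes m ++ pending (suc m) r)) (sym (B-grow m K+m<N))
        (WideMergeSeq-resp-↭ (++⁺ʳ (pending (suc m) r) (boxes-rotate m))
          (RedBelow-state (suc m) r (boxes-rotate m) eq′) (sweep (suc m) r eq′)))
    where
    K+m<N : K + m < N
    K+m<N = subst (K + m <_) (trans (sym (+-suc (K + m) r)) eq) (s≤s (m≤m+n (K + m) r))

    eq′ : K + suc m + r ≡ N
    eq′ = trans (cong (_+ r) (+-suc K m)) (trans (sym (+-suc (K + m) r)) eq)

  state-initial : ∀ r → state 0 r ≡ applyUpTo p (K + r)
  state-initial r = begin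
    boxes 0 ++ pending 0 r
      ≡⟨ cong₂ _++_ (applyUpTo-cong K λ i i<K → trans (cong B (+-identityʳ i)) (B-start i i<K))
                    (applyUpTo-cong r λ i _ → cong p (trans (cong (i +_) (+-identityʳ K)) (+-comm i K))) ⟩
    applyUpTo p K ++ applyUpTo (λ i → p (K + i)) r
      ≡⟨ applyUpTo-+ p K r ⟨
    applyUpTo p (K + r)
      ∎
    where open ≡-Reasoning

  sweep-all : K ≤ N → WideMergeSeq K (applyUpTo p N)
  sweep-all K≤N = subst (WideMergeSeq K ∘ applyUpTo p) (m+[n∸m]≡n K≤N)
    (subst (WideMergeSeq K) (state-initial (N ∸ K))
      (sweep 0 (N ∸ K) (trans (cong (_+ (N ∸ K)) (+-identityʳ K)) (m+[n∸m]≡n K≤N))))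

-- A K × L array of rectangles pt i s (i < K, s < L) swept row after row, box i
-- growing along column i; two cells are compared in the row-major order s * K + i.
module GridSweep (w L : ℕ) (pt box : ℕ → ℕ → Rect)
  (box-start     : ∀ i → i < suc w → box i 0 ≡ pt i 0)
  (box-grow      : ∀ i s → i < suc w → bbox (box i s) (pt i (suc s)) ≡ box i (suc s))
  (box-separated : ∀ i s i′ j → i < suc w → i′ < suc w → s < L → j < L →
                   s * suc w + i < j * suc w + i′ → Homogeneous (box i s) (pt i′ j))
  where

  K : ℕ
  K = suc w

  cell : ℕ → Rect
  cell n = pt (n % K) (n / K)

  rows≡cells : concat (applyUpTo (λ s → applyUpTo (λ i → pt i s) K) L) ≡ applyUpTo cell (L * K)
  rows≡cells = sym (trans (applyUpTo-blocks cell L K) (cong concat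
    (applyUpTo-cong L λ s _ → applyUpTo-cong K λ i i<K →
      cong₂ pt ([m*n+o]%n≡o s K i<K) ([m*n+o]/n≡m s K i<K))))

  box-cell : ℕ → Rect
  box-cell n = box (n % K) (n / K)

  box-cell-start : ∀ n → n < K → box-cell n ≡ cell n
  box-cell-start n n<K rewrite m<n⇒m/n≡0 n<K = box-start (n % K) (m%n<n n K)

  box-cell-grow : ∀ n → K + n < L * K → bbox (box-cell n) (cell (K + n)) ≡ box-cell (K + n)
  box-cell-grow n _ rewrite trans (%-congˡ (+-comm K n)) ([m+n]%n≡m%n n K)
                          | trans (m/n≡1+[m∸n]/n (m≤m+n K n)) (cong (λ m → suc (m / K)) (m+n∸m≡n K n))
                          = box-grow (n % K) (n / K) (m%n<n n K)

  box-cell-separated : ∀ n n′ → n < n′ → n′ < L * K → Homogeneous (box-cell n) (cell n′)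
  box-cell-separated n n′ n<n′ n′<N = box-separated (n % K) (n / K) (n′ % K) (n′ / K)
    (m%n<n n K) (m%n<n n′ K) (m<n*o⇒m/o<n (<-trans n<n′ n′<N)) (m<n*o⇒m/o<n n′<N)
    (subst₂ _<_ (sym (/-%-decomposition n K)) (sym (/-%-decomposition n′ K)) n<n′)

  open Sweep w (L * K) cell box-cell box-cell-start box-cell-grow box-cell-separated
    public using (sweep-all; p-pairwise)

-- Lower bound: the first merge

Apart : ℕ → Rect → Rect → Set
Apart M a b = Σ Axis λ ax → Separated M ax a b

Apart-sym : ∀ {M a b} → Apart M a b → Apart M b a
Apart-sym {a = a} {b} (ax , sep) = ax , Separated-sym ax a b sep

-- Along ax, F is a permutation point set: its coordinates are 1, …, N, each taken once.
record Enumeration (ax : Axis) (N : ℕ) (F : Family) : Set where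
  field
    pointAt       : ℕ → Point
    coord-pointAt : ∀ n → coord ax (pointAt n) ≡ suc n
    enumerates    : F ↭ applyUpTo (pointRect ∘ pointAt) N

Gap-overlap : ∀ {a₁ a₂ c} → a₁ ≤ c → c ≤ a₂ → Gap 1 a₁ a₂ c c → ⊥
Gap-overlap a₁≤c c≤a₂ (inj₁ a₂<c) = <⇒≱ a₂<c c≤a₂
Gap-overlap a₁≤c c≤a₂ (inj₂ c<a₁) = <⇒≱ c<a₁ a₁≤c

clash-within : ∀ ax box q → lo ax box ≤ coord ax q → coord ax q ≤ hi ax box → clash box (pointRect q) ≡ 1
clash-within horizontal box q lo≤c c≤hi =
  clash-inhomogeneous {box} {pointRect q} λ h → Gap-overlap lo≤c c≤hi (homogeneous⁻ h horizontal)
clash-within vertical   box q lo≤c c≤hi =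
  clash-inhomogeneous {box} {pointRect q} λ h → Gap-overlap lo≤c c≤hi (homogeneous⁻ h vertical)

-- hi ∸ pred lo is the number of coordinates lo, …, hi (when lo ≥ 1).
redCount-span : ∀ ax N (q : ℕ → Point) → (∀ n → coord ax (q n) ≡ suc n) → ∀ box → hi ax box ≤ N →
                hi ax box ∸ pred (lo ax box) ≤ redCount box (applyUpTo (pointRect ∘ q) N)
redCount-span ax N q coord≡ box hi≤N =
  subst (_ ≤_) (sym (cong sum (map-applyUpTo (pointRect ∘ q) (clash box) N)))
    (sum-applyUpTo-≥ (clash box ∘ pointRect ∘ q) N hit hi≤N)
  where
  pred≤⇒≤suc : ∀ {m n} → pred m ≤ n → m ≤ suc n
  pred≤⇒≤suc {zero}  _   = z≤n
  pred≤⇒≤suc {suc m} m≤n = s≤s m≤n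

  hit : ∀ n → pred (lo ax box) ≤ n → n < hi ax box → 1 ≤ clash box (pointRect (q n))
  hit n lo≤1+n n<hi = ≤-reflexive (sym (clash-within ax box (q n)
    (subst (lo ax box ≤_) (sym (coord≡ n)) (pred≤⇒≤suc lo≤1+n)) (subst (_≤ hi ax box) (sym (coord≡ n)) n<hi)))

∈-enumeration : ∀ {ax N F a} → Enumeration ax N F → a ∈ F → 1 ≤ lo ax a × lo ax a ≤ hi ax a × hi ax a ≤ N
∈-enumeration {ax} e a∈F
  with ∈-applyUpTo⁻ (pointRect ∘ Enumeration.pointAt e) (∈-resp-↭ (Enumeration.enumerates e) a∈F)
... | i , i<N , refl rewrite lo-point ax (Enumeration.pointAt e i) | hi-point ax (Enumeration.pointAt e i)
                           | Enumeration.coord-pointAt e i = s≤s z≤n , ≤-refl , i<N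

Gap-span : ∀ {M u₁ u₂ v₁ v₂} → u₁ ≤ u₂ → v₁ ≤ v₂ → Gap M u₁ u₂ v₁ v₂ → M + (u₁ ⊓ v₁) ≤ u₂ ⊔ v₂
Gap-span {M} {u₁} {u₂} {v₁} {v₂} u₁≤u₂ v₁≤v₂ (inj₁ M+u₂≤v₁) =
  ≤-trans (+-monoʳ-≤ M (≤-trans (m⊓n≤m u₁ v₁) u₁≤u₂)) (≤-trans M+u₂≤v₁ (≤-trans v₁≤v₂ (m≤n⊔m u₂ v₂)))
Gap-span {M} {u₁} {u₂} {v₁} {v₂} u₁≤u₂ v₁≤v₂ (inj₂ M+v₂≤u₁) =
  ≤-trans (+-monoʳ-≤ M (≤-trans (m⊓n≤n u₁ v₁) v₁≤v₂)) (≤-trans M+v₂≤u₁ (≤-trans u₁≤u₂ (m≤m⊔n u₂ v₂)))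

-- The rectangle created by the first merge of a point set spanning 1..N along both axes
-- stretches over at least M + 1 coordinates along some axis, so it meets M + 1 points.
first-merge : ∀ {M N F a b rest} → AllPairs (Apart M) F → (∀ ax → Enumeration ax N F) →
              F ↭ a ∷ b ∷ rest → M ≤ suc (redCount (bbox a b) rest)
first-merge {M} {N} {F} {a} {b} {rest} apart enum F↭ with AllPairs-resp-↭ Apart-sym F↭ apart
... | ((ax , sep) ∷ _) ∷ _
    with ∈-enumeration (enum ax) (∈-resp-↭ (↭-sym F↭) (here refl))
       | ∈-enumeration (enum ax) (∈-resp-↭ (↭-sym F↭) (there (here refl)))
...   | 1≤loᵃ , lo≤hiᵃ , hi≤Nᵃ | 1≤loᵇ , lo≤hiᵇ , hi≤Nᵇ = ≤-pred (begin
  suc M                                ≤⟨ span-count (Gap-span lo≤hiᵃ lo≤hiᵇ sep) (⊓-glb 1≤loᵃ 1≤loᵇ) ⟩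
  (hi ax a ⊔ hi ax b) ∸ pred (lo ax a ⊓ lo ax b)
                                       ≡⟨ cong₂ (λ h l → h ∸ pred l) (hi-bbox ax a b) (lo-bbox ax a b) ⟨
  hi ax box ∸ pred (lo ax box)         ≤⟨ redCount-span ax N pointAt coord-pointAt box
                                            (subst (_≤ N) (sym (hi-bbox ax a b)) (⊔-lub hi≤Nᵃ hi≤Nᵇ)) ⟩
  redCount box (applyUpTo (pointRect ∘ pointAt) N)
                                       ≡⟨ sum-↭ (map⁺ (clash box) (↭-trans (↭-sym enumerates) F↭)) ⟩
  clash box a + (clash box b + redCount box rest)
                                       ≤⟨ +-mono-≤ (clash≤1 box a) (+-monoˡ-≤ _ (clash≤1 box b)) ⟩
  2 + redCount box rest                ∎)
  where
  open ≤-Reasoning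
  open Enumeration (enum ax)

  box : Rect
  box = bbox a b

  span-count : ∀ {l h} → M + l ≤ h → 1 ≤ l → suc M ≤ h ∸ pred l
  span-count {suc l} {h} M+l≤h _ = m+n≤o⇒m≤o∸n (suc M) (subst (_≤ h) (+-suc M l) M+l≤h)

merge-lower-bound : ∀ {M N d F} → 2 ≤ N → AllPairs (Apart M) F → (∀ ax → Enumeration ax N F) →
                    WideMergeSeq d F → M ≤ d
merge-lower-bound {N = N} 2≤N _ enum (done r _) = ⊥-elim (<-irrefl 1≡N 2≤N)
  where
  open Enumeration (enum horizontal)
  1≡N : 1 ≡ N
  1≡N = trans (↭-length enumerates) (length-applyUpTo (pointRect ∘ pointAt) N)
merge-lower-bound 2≤N apart enum (step _ (a , b , rest , F↭ , refl) seq) =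
  ≤-trans (first-merge apart enum F↭)
          (subst (_< _) (redDeg-head (bbox a b) rest) (WideMergeSeq-RedBelow seq fzero))

-- The grid permutation

module Grid (k ℓ : ℕ) where

  point : ℕ → ℕ → Point
  point i j = (i * ℓ + (ℓ ∸ j) , j * k + suc i)

  cellRect : ℕ → ℕ → Rect
  cellRect i j = pointRect (point i j)

  -- The bounding box of the cells (i , 0), …, (i , s).
  columnBox : ℕ → ℕ → Rect
  columnBox i s = rect (i * ℓ + (ℓ ∸ s)) (i * ℓ + ℓ) (suc i) (s * k + suc i)

  columnBox-grow : ∀ i s → bbox (columnBox i s) (cellRect i (suc s)) ≡ columnBox i (suc s)
  columnBox-grow i s = rect-≡
    (m≥n⇒m⊓n≡n (+-monoʳ-≤ (i * ℓ) (∸-monoʳ-≤ ℓ (n≤1+n s))))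
    (m≥n⇒m⊔n≡m (+-monoʳ-≤ (i * ℓ) (m∸n≤m ℓ (suc s))))
    (m≤n⇒m⊓n≡m (m≤n+m (suc i) (suc s * k)))
    (m≤n⇒m⊔n≡n (+-monoˡ-≤ (suc i) (m≤n+m (s * k) k)))

  columnBox-separated : ∀ i s i′ j → i < k → i′ < k → s < ℓ → j < ℓ →
                        s * k + i < j * k + i′ → Homogeneous (columnBox i s) (cellRect i′ j)
  columnBox-separated i s i′ j i<k i′<k s<ℓ j<ℓ lex =
    homogeneous⁺ {columnBox i s} {cellRect i′ j} horizontal-gap vertical-gap
    where
    vertical-gap : Separated 1 vertical (columnBox i s) (cellRect i′ j)
    vertical-gap = inj₁ (subst₂ _<_ (sym (+-suc (s * k) i)) (sym (+-suc (j * k) i′)) (s<s lex))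

    horizontal-gap : Separated 1 horizontal (columnBox i s) (cellRect i′ j)
    horizontal-gap with <-cmp i i′
    ... | tri< i<i′ _ _ = inj₁ (*+-<-lex ℓ i<i′ (m<m+n ℓ (m<n⇒0<n∸m j<ℓ)))
    ... | tri> _ _ i′<i = inj₂ (*+-<-lex ℓ i′<i (≤-<-trans (m∸n≤m ℓ j) (m<m+n ℓ (m<n⇒0<n∸m s<ℓ))))
    ... | tri≈ _ refl _ with *+-<-lex⁻ k {s} {j} i′<k lex
    ...   | inj₁ s<j         = inj₂ (+-monoʳ-< (i * ℓ) (∸-monoʳ-< s<j (<⇒≤ j<ℓ)))
    ...   | inj₂ (_ , i<i)   = ⊥-elim (<-irrefl refl i<i)

  -- Within column block i, row block opposite g has x-coordinate i * ℓ + suc g.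
  opposite : ℕ → ℕ
  opposite g = ℓ ∸ suc g

  ℓ∸opposite : ∀ {g} → g < ℓ → ℓ ∸ opposite g ≡ suc g
  ℓ∸opposite = m∸[m∸n]≡n

  opposite-< : ∀ {g g′} → g < g′ → g′ < ℓ → opposite g′ < opposite g
  opposite-< g<g′ g′<ℓ = ∸-monoʳ-< (s<s g<g′) g′<ℓ

  -- The bounding box of the cells (0 , opposite g), …, (s , opposite g).
  rowBox : ℕ → ℕ → Rect
  rowBox g s = rect (suc g) (s * ℓ + suc g) (opposite g * k + 1) (opposite g * k + suc s)

  rowBox-start : ∀ g → g < ℓ → rowBox g 0 ≡ cellRect 0 (opposite g)
  rowBox-start g g<ℓ = rect-≡ (sym (ℓ∸opposite g<ℓ)) (sym (ℓ∸opposite g<ℓ)) refl refl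

  rowBox-grow : ∀ g s → g < ℓ → bbox (rowBox g s) (cellRect (suc s) (opposite g)) ≡ rowBox g (suc s)
  rowBox-grow g s g<ℓ rewrite ℓ∸opposite g<ℓ = rect-≡
    (m≤n⇒m⊓n≡m (m≤n+m (suc g) (suc s * ℓ)))
    (m≤n⇒m⊔n≡n (+-monoˡ-≤ (suc g) (m≤n+m (s * ℓ) ℓ)))
    (m≤n⇒m⊓n≡m (+-monoʳ-≤ (opposite g * k) (s≤s z≤n)))
    (m≤n⇒m⊔n≡n (+-monoʳ-≤ (opposite g * k) (n≤1+n (suc s))))

  rowBox-separated : ∀ g s g′ j → g < ℓ → g′ < ℓ → s < k → j < k →
                     s * ℓ + g < j * ℓ + g′ → Homogeneous (rowBox g s) (cellRect j (opposite g′))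
  rowBox-separated g s g′ j g<ℓ g′<ℓ s<k j<k lex =
    homogeneous⁺ {rowBox g s} {cellRect j (opposite g′)} horizontal-gap vertical-gap
    where
    horizontal-gap : Separated 1 horizontal (rowBox g s) (cellRect j (opposite g′))
    horizontal-gap = inj₁ (subst₂ _<_ (sym (+-suc (s * ℓ) g))
      (trans (sym (+-suc (j * ℓ) g′)) (cong (j * ℓ +_) (sym (ℓ∸opposite g′<ℓ)))) (s<s lex))

    vertical-gap : Separated 1 vertical (rowBox g s) (cellRect j (opposite g′))
    vertical-gap with <-cmp g g′
    ... | tri< g<g′ _ _ = inj₂ (*+-<-lex k (opposite-< g<g′ g′<ℓ) (subst (suc j <_) (+-comm 1 k) (s<s j<k)))
    ... | tri> _ _ g′<g = inj₁ (*+-<-lex k (opposite-< g′<g g<ℓ)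
                            (subst (suc s <_) (sym (+-suc k j)) (s<s (≤-trans s<k (m≤m+n k j)))))
    ... | tri≈ _ refl _ with *+-<-lex⁻ ℓ {s} {j} g′<ℓ lex
    ...   | inj₁ s<j       = inj₁ (+-monoʳ-< (opposite g * k) (s<s s<j))
    ...   | inj₂ (_ , g<g) = ⊥-elim (<-irrefl refl g<g)

  cells : List Rect
  cells = concat (applyUpTo (λ i → applyUpTo (cellRect i) ℓ) k)

  gridRects≡cells : map pointRect (gridPoints k ℓ) ≡ cells
  gridRects≡cells = begin
    map pointRect (gridPoints k ℓ)
      ≡⟨ map-concatMap pointRect (λ i → map (point i) (upTo ℓ)) (upTo k) ⟩
    concat (map (λ i → map pointRect (map (point i) (upTo ℓ))) (upTo k))
      ≡⟨ cong concat (map-upTo _ k) ⟩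
    concat (applyUpTo (λ i → map pointRect (map (point i) (upTo ℓ))) k)
      ≡⟨ cong concat (applyUpTo-cong k λ i _ → trans (sym (map-∘ (upTo ℓ))) (map-upTo (cellRect i) ℓ)) ⟩
    cells
      ∎
    where open ≡-Reasoning

  cells-apart : ∀ i j i′ j′ → i′ < k → j * k + suc i < j′ * k + suc i′ →
                Apart (k ⊓ ℓ) (cellRect i j) (cellRect i′ j′)
  cells-apart i j i′ j′ i′<k y<y′
    with *+-<-lex⁻ k {j} {j′} i′<k (s<s⁻¹ (subst₂ _<_ (+-suc (j * k) i) (+-suc (j′ * k) i′) y<y′))
  ... | inj₂ (refl , i<i′) = horizontal , inj₁ (*+-≤-lex ℓ (m⊓n≤n k ℓ) i<i′ ≤-refl)
  ... | inj₁ j<j′ with i ≤? i′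
  ...   | yes i≤i′ = vertical , inj₁ (*+-≤-lex k (m⊓n≤m k ℓ) j<j′ (s≤s i≤i′))
  ...   | no  i≰i′ = horizontal , inj₂ (*+-≤-lex ℓ (m⊓n≤n k ℓ) (≰⇒> i≰i′) (∸-monoʳ-≤ ℓ (<⇒≤ j<j′)))

  homogeneous-cells-apart : ∀ i j i′ j′ → i < k → i′ < k → Homogeneous (cellRect i j) (cellRect i′ j′) →
                            Apart (k ⊓ ℓ) (cellRect i j) (cellRect i′ j′)
  homogeneous-cells-apart i j i′ j′ i<k i′<k h with homogeneous⁻ h vertical
  ... | inj₁ y<y′ = cells-apart i j i′ j′ i′<k y<y′
  ... | inj₂ y′<y = Apart-sym (cells-apart i′ j′ i j i<k y′<y)

module GridTwinWidth (k′ ℓ′ : ℕ) where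

  k ℓ : ℕ
  k = suc k′
  ℓ = suc ℓ′

  open Grid k ℓ

  module Columns = GridSweep k′ ℓ cellRect columnBox
    (λ _ _ → refl) (λ i s _ → columnBox-grow i s) columnBox-separated
  module Rows = GridSweep ℓ′ k (λ g s → cellRect s (opposite g)) rowBox
    rowBox-start rowBox-grow rowBox-separated

  F₀ : Family
  F₀ = map pointRect (gridPoints k ℓ)

  F₀↭columns : F₀ ↭ applyUpTo Columns.cell (ℓ * k)
  F₀↭columns = ↭-trans (↭-reflexive gridRects≡cells)
    (↭-trans (concat-applyUpTo-transpose cellRect k ℓ) (↭-reflexive Columns.rows≡cells))

  F₀↭rows : F₀ ↭ applyUpTo Rows.cell (ℓ * k)
  F₀↭rows = ↭-trans (↭-reflexive gridRects≡cells)
    (↭-trans (concat-applyUpTo-↭ k λ i _ → ↭-sym (applyUpTo-reverse (cellRect i) ℓ))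
      (↭-reflexive (trans Rows.rows≡cells (cong (applyUpTo Rows.cell) (*-comm k ℓ)))))

  F₀-pairwise : AllPairs Homogeneous F₀
  F₀-pairwise = AllPairs-resp-↭ Homogeneous-sym (↭-sym F₀↭columns)
    (AllPairs.applyUpTo⁺₁ Columns.cell (ℓ * k) λ {n} {n′} → Columns.p-pairwise n n′)

  F₀-RedBelow : ∀ {d} → 1 ≤ d → RedBelow d F₀
  F₀-RedBelow 1≤d = RedBelow-++ [] F₀ 1≤d z≤n [] F₀-pairwise

  upper-bound : HasWideMergeSeq (k ⊓ ℓ) (gridPoints k ℓ)
  upper-bound with k ≤? ℓ
  ... | yes k≤ℓ rewrite m≤n⇒m⊓n≡m k≤ℓ =
        WideMergeSeq-resp-↭ F₀↭columns (F₀-RedBelow (s≤s z≤n)) (Columns.sweep-all (m≤n*m k ℓ))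
  ... | no  k≰ℓ rewrite m≥n⇒m⊓n≡n (<⇒≤ (≰⇒> k≰ℓ)) =
        WideMergeSeq-resp-↭ F₀↭rows (F₀-RedBelow (s≤s z≤n))
          (subst (WideMergeSeq ℓ ∘ applyUpTo Rows.cell) (*-comm k ℓ) (Rows.sweep-all (m≤n*m ℓ k)))

  F₀-apart : AllPairs (Apart (k ⊓ ℓ)) F₀
  F₀-apart = AllPairs-resp-↭ Apart-sym (↭-sym F₀↭columns)
    (AllPairs.applyUpTo⁺₁ Columns.cell (ℓ * k) λ {n} {n′} n<n′ n′<N →
      homogeneous-cells-apart (n % k) (n / k) (n′ % k) (n′ / k) (m%n<n n k) (m%n<n n′ k)
        (Columns.p-pairwise n n′ n<n′ n′<N))

  F₀-enumeration : ∀ ax → Enumeration ax (ℓ * k) F₀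
  F₀-enumeration horizontal = record
    { pointAt       = λ n → point (n / ℓ) (opposite (n % ℓ))
    ; coord-pointAt = λ n → trans (cong ((n / ℓ) * ℓ +_) (ℓ∸opposite (m%n<n n ℓ)))
                                  (trans (+-suc _ _) (cong suc (/-%-decomposition n ℓ)))
    ; enumerates    = F₀↭rows
    }
  F₀-enumeration vertical = record
    { pointAt       = λ n → point (n % k) (n / k)
    ; coord-pointAt = λ n → trans (+-suc _ _) (cong suc (/-%-decomposition n k))
    ; enumerates    = F₀↭columns
    }

  lower-bound : ∀ d → HasWideMergeSeq d (gridPoints k ℓ) → k ⊓ ℓ ≤ d
  lower-bound d seq with k ⊓ ℓ ≤? 1
  ... | yes k⊓ℓ≤1 = ≤-trans k⊓ℓ≤1 (WideMergeSeq-width seq)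
  ... | no  k⊓ℓ≰1 = merge-lower-bound (≤-trans (≰⇒> k⊓ℓ≰1) (≤-trans (m⊓n≤m k ℓ) (m≤n*m k ℓ)))
                      F₀-apart F₀-enumeration seq

lemma2p3 : (k ℓ : ℕ) → k ≥ 1 → ℓ ≥ 1 → IsTwinWidth (gridPoints k ℓ) (k ⊓ ℓ)
lemma2p3 (suc k′) (suc ℓ′) _ _ = upper-bound , lower-bound
  where open GridTwinWidth k′ ℓ′
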